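{- Let $p$ be an odd prime, $s\ge2$, $m\ge1$, $R$ the Galois ring of characteristic $p^{s}$ and cardinality $p^{sm}$, $\nu\ge1$ and $\delta\in\{0,1,2\}$. Let $[\alpha]=[a_1,a_2,\dots,a_{2\nu+\delta}]$ be a vertex of $\Gamma^{2\nu+\delta}$ such that $a_i\in R^{*}$ for some $i\in\{2,3,\dots,2\nu\}$. Then there exists an element of $G_{[e_1]}$ carrying $[\alpha]$ to $[e_2]$ if $\nu=1$, and to one of $[e_{\nu+1}]$, $[e_2]$, or $[e_2+p^{r}e_{\nu+1}]$ for some integer $r$ with $0<r<s$, if $\nu\ge2$.
   Context: $R$ is a finite local ring with maximal ideal $pR$ and residue field of order $p^{m}$; $R^{*}$ is its unit group and $z$ a fixed non-square element of $R^{*}$. Vectors of length $2\nu+\delta$ over $R$ having some unit coordinate are considered up to multiplication by units; $[a_1,\dots,a_{2\nu+\delta}]$ denotes the class, and $e_i$ is the $i$-th standard basis vector. Let $S=\begin{pmatrix}0&I^{(\nu)}&0\\ I^{(\nu)}&0&0\\0&0&\Delta\end{pmatrix}$ with $\Delta$ absent if $\delta=0$, $\Delta=(1)$ or $(z)$ (one fixed choice) if $\delta=1$, $\Delta=\mathrm{diag}(1,-z)$ if $\delta=2$. The orthogonal graph $\Gamma^{2\nu+\delta}$ has vertices the classes $[\alpha]$ with $\alpha S\alpha^{t}=0$, and $[\alpha]\sim[\beta]$ iff $\alpha S\beta^{t}\in R^{*}$. $\mathrm{O}_{2\nu+\delta}(R)=\{T: TST^{t}=S\}$ acts on vertices by $[\alpha]\mapsto[\alpha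 T]$, and $G_{[e_1]}$ is the stabilizer of the vertex $[e_1]$ in $\mathrm{O}_{2\nu+\delta}(R)$. The paper's standing assumption is $s\ge2$. -}

module Defs where

open import Level using (Level; _⊔_)
open import Algebra.Bundles using (CommutativeRing)
open import Data.Nat as ℕ using (ℕ; zero; suc; _<_; _≤_; _^_; _≡ᵇ_)
open import Data.Fin as Fin using (Fin; toℕ; splitAt)
open import Data.Sum using (_⊎_; inj₁; inj₂)
open import Data.Product using (Σ; ∃; _×_; _,_; ∃-syntax)
open import Relation.Nullary using (¬_)
open import Data.Bool using (Bool; true; false; if_then_else_)
open import Relation.Binary.PropositionalEquality using (_≡_)

module RingDefs {c ℓ} (R : CommutativeRing c ℓ) where
  open CommutativeRing R

  ι : ℕ → Carrier
  ι zero = 0#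
  ι (suc n) = 1# + ι n

  Unit : Carrier → Set (c ⊔ ℓ)
  Unit x = ∃[ y ] (x * y ≈ 1#)

  IsSquare : Carrier → Set (c ⊔ ℓ)
  IsSquare x = ∃[ w ] (w * w ≈ x)

  sum : ∀ {n} → (Fin n → Carrier) → Carrier
  sum {zero} f = 0#
  sum {suc n} f = f Fin.zero + sum (λ i → f (Fin.suc i))

  -- R is the Galois ring of characteristic p^s and cardinality p^(s m):
  -- a finite commutative local ring whose maximal ideal (set of non-units) is pR,
  -- of characteristic p^s and with exactly p^(s m) elements.
  record IsGaloisRing (p s m : ℕ) : Set (c ⊔ ℓ) where
    field
      char-kills : ι (p ^ s) ≈ 0#
      char-min   : ∀ k → 0 < k → k < p ^ s → ¬ (ι k ≈ 0#)
      enum       : Fin (p ^ (s ℕ.* m)) → Carrier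
      enum-inj   : ∀ i j → enum i ≈ enum j → i ≡ j
      enum-surj  : ∀ x → ∃[ i ] (enum i ≈ x)
      nonunit⇒pR : ∀ x → ¬ Unit x → ∃[ y ] (x ≈ ι p * y)
      pR⇒nonunit : ∀ x → ∃[ y ] (x ≈ ι p * y) → ¬ Unit x

  -- standard basis vector e_{k+1} (0-based index k) of length n
  e : ∀ {n} → ℕ → Fin n → Carrier
  e k j = if toℕ j ≡ᵇ k then 1# else 0#

  -- Orthogonal geometry of dimension ν + ν + δ.
  -- z is the fixed non-square unit; b chooses Δ for δ = 1:
  -- b = false gives Δ = (1), b = true gives Δ = (z).
  module Orth (ν δ : ℕ) (z : Carrier) (b : Bool) where

    Vec : Set c
    Vec = Fin (ν ℕ.+ ν ℕ.+ δ) → Carrier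

    Mat : Set c
    Mat = Fin (ν ℕ.+ ν ℕ.+ δ) → Fin (ν ℕ.+ ν ℕ.+ δ) → Carrier

    kδ : Fin ν → Fin ν → Carrier
    kδ i j = if toℕ i ≡ᵇ toℕ j then 1# else 0#

    Δmat : (d : ℕ) → Fin d → Fin d → Carrier
    Δmat (suc zero) Fin.zero Fin.zero = if b then z else 1#
    Δmat (suc (suc zero)) Fin.zero Fin.zero = 1#
    Δmat (suc (suc zero)) (Fin.suc Fin.zero) (Fin.suc Fin.zero) = - z
    Δmat _ _ _ = 0#

    S-hyp : Fin ν ⊎ Fin ν → Fin ν ⊎ Fin ν → Carrier
    S-hyp (inj₁ a) (inj₂ c') = kδ a c'
    S-hyp (inj₂ a) (inj₁ c') = kδ a c'
    S-hyp _ _ = 0#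

    S-blk : Fin (ν ℕ.+ ν) ⊎ Fin δ → Fin (ν ℕ.+ ν) ⊎ Fin δ → Carrier
    S-blk (inj₁ i) (inj₁ j) = S-hyp (splitAt ν i) (splitAt ν j)
    S-blk (inj₂ i) (inj₂ j) = Δmat δ i j
    S-blk _ _ = 0#

    -- S = [[0, I, 0], [I, 0, 0], [0, 0, Δ]]
    S : Mat
    S i j = S-blk (splitAt (ν ℕ.+ ν) i) (splitAt (ν ℕ.+ ν) j)

    form : Vec → Vec → Carrier
    form α β = sum (λ i → sum (λ j → α i * S i j * β j))

    IsVertex : Vec → Set (c ⊔ ℓ)
    IsVertex α = (∃[ i ] Unit (α i)) × (form α α ≈ 0#)

    SameClass : Vec → Vec → Set (c ⊔ ℓ)
    SameClass α β = ∃[ u ] (Unit u × (∀ k → α k ≈ u * β k))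

    act : Vec → Mat → Vec
    act α T k = sum (λ j → α j * T j k)

    InO : Mat → Set ℓ
    InO T = ∀ i k → sum (λ j → sum (λ l → T i j * S j l * T k l)) ≈ S i k

    InStab : Mat → Set (c ⊔ ℓ)
    InStab T = InO T × SameClass (act (e 0) T) (e 0)

    Carries : Vec → Vec → Set (c ⊔ ℓ)
    Carries α β = ∃[ T ] (InStab T × SameClass (act α T) β)

-- Write B(x, y) = x S yᵗ, so that B(x, e_j) = x_{ν+j} and B(x, e_{ν+j}) = x_j for j ≤ ν (below, e k is e_{k+1}).
-- Eichler transformations x ↦ x + B(x,u)(w + c u) − B(x,w) u and reflections are linear isometries fixing every
-- vector orthogonal to their data; when that data is orthogonal to e₁, their matrices lie in G_[e₁]. An Eichler
-- transformation carries an isotropic a to an isotropic t whenever some isotropic u ⊥ e₁ has B(a,u) = B(t,u) a unit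
-- and B(e₁,a) = B(e₁,t).
--
-- Let β = α_{ν+1} = B(e₁,α). If β is a unit, α is carried to β e_{ν+1}. Otherwise some α_j or α_{ν+j} with
-- 2 ≤ j ≤ ν is a unit μ, and α is carried to μ e_j + β e_{ν+1} (in the second case via μ e_{ν+j} + β e_{ν+1} and
-- the reflection swapping e_j and e_{ν+j}), then to μ e₂ + β e_{ν+1}; a product of two reflections rescales e₂ by
-- any unit while fixing e_{ν+1}. Finally, every non-unit of the Galois ring is 0 or p^r v with v a unit and
-- 0 < r < s, which gives the targets e₂ and e₂ + p^r e_{ν+1}.
module Submission where

open import Defs
open import Level using (_⊔_)
open import Algebra.Bundles using (CommutativeRing)
open import Data.Bool using (Bool; true; false; if_then_else_)
open import Data.Empty using (⊥-elim)
open import Data.Fin as Fin using (Fin; toℕ; splitAt; _↑ˡ_; _↑ʳ_; fromℕ<)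
import Data.Fin.Properties as Finₚ
open import Data.Nat as ℕ using (ℕ; zero; suc; _<_; _≤_; _^_; _≡ᵇ_; s≤s; z≤n)
import Data.Nat.Properties as ℕₚ
open import Data.Nat.Primality using (Prime)
open import Data.Product using (Σ; _×_; ∃-syntax; _,_)
open import Data.Sum using (_⊎_; inj₁; inj₂)
open import Function using (_∘_)
open import Relation.Nullary using (¬_; Dec; yes; no)
open import Relation.Binary.Definitions using (tri<; tri≈; tri>)
open import Relation.Binary.PropositionalEquality as ≡ using (_≡_; _≢_)

if-≡ᵇ-yes : ∀ {a} {A : Set a} {m n : ℕ} {x y : A} → m ≡ n → (if m ≡ᵇ n then x else y) ≡ x
if-≡ᵇ-yes {m = m} {n} m≡n with m ≡ᵇ n | ℕₚ.≡⇒≡ᵇ m n m≡n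
... | true | _ = ≡.refl

if-≡ᵇ-no : ∀ {a} {A : Set a} {m n : ℕ} {x y : A} → m ≢ n → (if m ≡ᵇ n then x else y) ≡ y
if-≡ᵇ-no {m = m} {n} m≢n with m ≡ᵇ n | ℕₚ.≡ᵇ⇒≡ m n
... | true  | ≡ᵇ⇒≡ = ⊥-elim (m≢n (≡ᵇ⇒≡ _))
... | false | _    = ≡.refl

if-≡ᵇ-sym : ∀ {a} {A : Set a} m n {x y : A} → (if m ≡ᵇ n then x else y) ≡ (if n ≡ᵇ m then x else y)
if-≡ᵇ-sym m n with m ℕ.≟ n
... | yes m≡n = ≡.trans (if-≡ᵇ-yes m≡n) (≡.sym (if-≡ᵇ-yes (≡.sym m≡n)))
... | no  m≢n = ≡.trans (if-≡ᵇ-no m≢n) (≡.sym (if-≡ᵇ-no (m≢n ∘ ≡.sym)))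

toℕ-splitAt-inj₁ : ∀ {m n} {i : Fin (m ℕ.+ n)} {j} → splitAt m i ≡ inj₁ j → toℕ i ≡ toℕ j
toℕ-splitAt-inj₁ {n = n} {j = j} eq =
  ≡.trans (≡.cong toℕ (≡.sym (Finₚ.splitAt⁻¹-↑ˡ eq))) (Finₚ.toℕ-↑ˡ j n)

toℕ-splitAt-inj₂ : ∀ {m n} {i : Fin (m ℕ.+ n)} {j} → splitAt m i ≡ inj₂ j → toℕ i ≡ m ℕ.+ toℕ j
toℕ-splitAt-inj₂ {m} {j = j} eq =
  ≡.trans (≡.cong toℕ (≡.sym (Finₚ.splitAt⁻¹-↑ʳ eq))) (Finₚ.toℕ-↑ʳ m j)

module Sums {c ℓ} (R : CommutativeRing c ℓ) where
  open CommutativeRing R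
  open RingDefs R
  import Algebra.Properties.Semiring.Sum semiring as ∑
  open import Relation.Binary.Reasoning.Setoid setoid

  sum≈∑ : ∀ {n} (f : Fin n → Carrier) → sum f ≈ ∑.sum f
  sum≈∑ {zero}  f = refl
  sum≈∑ {suc n} f = +-cong refl (sum≈∑ (λ i → f (Fin.suc i)))

  sum-cong : ∀ {n} {f g : Fin n → Carrier} → (∀ i → f i ≈ g i) → sum f ≈ sum g
  sum-cong {f = f} {g} f≈g = trans (sum≈∑ f) (trans (∑.sum-cong-≋ f≈g) (sym (sum≈∑ g)))

  sum-0# : ∀ {n} → sum {n} (λ _ → 0#) ≈ 0#
  sum-0# {n} = trans (sum≈∑ {n} (λ _ → 0#)) (∑.sum-replicate-zero n)

  sum-distrib-+ : ∀ {n} (f g : Fin n → Carrier) → sum (λ i → f i + g i) ≈ sum f + sum g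
  sum-distrib-+ f g = begin
    sum (λ i → f i + g i)   ≈⟨ sum≈∑ (λ i → f i + g i) ⟩
    ∑.sum (λ i → f i + g i) ≈⟨ ∑.∑-distrib-+ f g ⟩
    ∑.sum f + ∑.sum g       ≈⟨ +-cong (sym (sum≈∑ f)) (sym (sum≈∑ g)) ⟩
    sum f + sum g           ∎

  *-distribˡ-sum : ∀ {n} x (f : Fin n → Carrier) → x * sum f ≈ sum (λ i → x * f i)
  *-distribˡ-sum x f = begin
    x * sum f             ≈⟨ *-cong refl (sum≈∑ f) ⟩
    x * ∑.sum f           ≈⟨ ∑.*-distribˡ-sum x f ⟩
    ∑.sum (λ i → x * f i) ≈⟨ sym (sum≈∑ (λ i → x * f i)) ⟩
    sum (λ i → x * f i)   ∎

  sum-comm : ∀ {m n} (f : Fin m → Fin n → Carrier) →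
             sum (λ i → sum (λ j → f i j)) ≈ sum (λ j → sum (λ i → f i j))
  sum-comm f = begin
    sum (λ i → sum (λ j → f i j))     ≈⟨ sum-cong (λ i → sum≈∑ (f i)) ⟩
    sum (λ i → ∑.sum (λ j → f i j))   ≈⟨ sum≈∑ (λ i → ∑.sum (λ j → f i j)) ⟩
    ∑.sum (λ i → ∑.sum (λ j → f i j)) ≈⟨ ∑.∑-comm f ⟩
    ∑.sum (λ j → ∑.sum (λ i → f i j)) ≈⟨ sym (sum≈∑ (λ j → ∑.sum (λ i → f i j))) ⟩
    sum (λ j → ∑.sum (λ i → f i j))   ≈⟨ sum-cong (λ j → sym (sum≈∑ (λ i → f i j))) ⟩
    sum (λ j → sum (λ i → f i j))     ∎

  e-same : ∀ {n k} (i : Fin n) → toℕ i ≡ k → e k i ≡ 1#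
  e-same _ = if-≡ᵇ-yes

  e-other : ∀ {n k} (i : Fin n) → toℕ i ≢ k → e k i ≡ 0#
  e-other _ = if-≡ᵇ-no

  e-sym : ∀ {n} (i j : Fin n) → e (toℕ i) j ≡ e (toℕ j) i
  e-sym i j = if-≡ᵇ-sym (toℕ j) (toℕ i)

  -- e (toℕ (suc k)) (suc j) reduces to e (toℕ k) j, so the induction needs no index arithmetic.
  sum-eˡ : ∀ {n} (k : Fin n) (g : Fin n → Carrier) → sum (λ j → e (toℕ k) j * g j) ≈ g k
  sum-eˡ {suc n} Fin.zero g = begin
    1# * g Fin.zero + sum (λ j → 0# * g (Fin.suc j))
      ≈⟨ +-cong (*-identityˡ _) (trans (sum-cong (λ j → zeroˡ (g (Fin.suc j)))) (sum-0# {n})) ⟩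
    g Fin.zero + 0#
      ≈⟨ +-identityʳ _ ⟩
    g Fin.zero
      ∎
  sum-eˡ {suc n} (Fin.suc k) g = begin
    0# * g Fin.zero + sum (λ j → e (toℕ k) j * g (Fin.suc j)) ≈⟨ +-cong (zeroˡ _) (sum-eˡ k (λ j → g (Fin.suc j))) ⟩
    0# + g (Fin.suc k)                                         ≈⟨ +-identityˡ _ ⟩
    g (Fin.suc k)                                              ∎

  sum-eʳ : ∀ {n} (k : Fin n) (g : Fin n → Carrier) → sum (λ j → g j * e (toℕ k) j) ≈ g k
  sum-eʳ k g = trans (sum-cong (λ j → *-comm (g j) _)) (sum-eˡ k g)

module Bilinear {c ℓ} (R : CommutativeRing c ℓ) {n : ℕ}
                (S : Fin n → Fin n → CommutativeRing.Carrier R)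
                (S-sym : ∀ i j → CommutativeRing._≈_ R (S i j) (S j i)) where
  open CommutativeRing R
  open RingDefs R
  open Sums R
  open import Relation.Binary.Reasoning.Setoid setoid
  open import Algebra.Solver.Ring.NaturalCoefficients.Default commutativeSemiring

  V : Set c
  V = Fin n → Carrier

  infixl 6 _⊕_
  infixr 7 _⊛_
  infix  4 _≋_

  _⊕_ : V → V → V
  (x ⊕ y) k = x k + y k

  _⊛_ : Carrier → V → V
  (a ⊛ x) k = a * x k

  _≋_ : V → V → Set ℓ
  x ≋ y = ∀ k → x k ≈ y k

  0v : V
  0v _ = 0#

  ≋-refl : ∀ {x} → x ≋ x
  ≋-refl _ = refl

  vsum : ∀ {m} → (Fin m → V) → V
  vsum g k = sum (λ j → g j k)

  basis-expansion : ∀ x → x ≋ vsum (λ j → x j ⊛ e (toℕ j))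
  basis-expansion x k = sym (trans (sum-cong (λ j → *-cong refl (reflexive (e-sym j k)))) (sum-eʳ k x))

  B : V → V → Carrier
  B x y = sum (λ i → sum (λ j → x i * S i j * y j))

  B-cong : ∀ {x x' y y'} → x ≋ x' → y ≋ y' → B x y ≈ B x' y'
  B-cong x≋x' y≋y' = sum-cong (λ i → sum-cong (λ j → *-cong (*-cong (x≋x' i) refl) (y≋y' j)))

  B-sym : ∀ x y → B x y ≈ B y x
  B-sym x y = trans (sum-comm (λ i j → x i * S i j * y j)) (sum-cong (λ j → sum-cong (λ i → swap i j)))
    where
    swap : ∀ i j → x i * S i j * y j ≈ y j * S j i * x i
    swap i j = trans (solve 3 (λ a s b → a :* s :* b := b :* s :* a) refl (x i) (S i j) (y j))
                     (*-cong (*-cong refl (S-sym i j)) refl)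

  private
    Sy : V → V
    Sy y i = sum (λ j → S i j * y j)

    B-as-row : ∀ x y → B x y ≈ sum (λ i → x i * Sy y i)
    B-as-row x y = sum-cong (λ i → trans (sum-cong (λ j → *-assoc (x i) (S i j) (y j)))
                                         (sym (*-distribˡ-sum (x i) (λ j → S i j * y j))))

  B-⊕ˡ : ∀ x x' y → B (x ⊕ x') y ≈ B x y + B x' y
  B-⊕ˡ x x' y = begin
    B (x ⊕ x') y                                         ≈⟨ B-as-row (x ⊕ x') y ⟩
    sum (λ i → (x i + x' i) * Sy y i)                    ≈⟨ sum-cong (λ i → distribʳ (Sy y i) (x i) (x' i)) ⟩
    sum (λ i → x i * Sy y i + x' i * Sy y i)             ≈⟨ sum-distrib-+ (λ i → x i * Sy y i) (λ i → x' i * Sy y i) ⟩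
    sum (λ i → x i * Sy y i) + sum (λ i → x' i * Sy y i) ≈⟨ +-cong (sym (B-as-row x y)) (sym (B-as-row x' y)) ⟩
    B x y + B x' y                                       ∎

  B-⊛ˡ : ∀ a x y → B (a ⊛ x) y ≈ a * B x y
  B-⊛ˡ a x y = begin
    B (a ⊛ x) y                    ≈⟨ B-as-row (a ⊛ x) y ⟩
    sum (λ i → a * x i * Sy y i)   ≈⟨ sum-cong (λ i → *-assoc a (x i) (Sy y i)) ⟩
    sum (λ i → a * (x i * Sy y i)) ≈⟨ sym (*-distribˡ-sum a (λ i → x i * Sy y i)) ⟩
    a * sum (λ i → x i * Sy y i)   ≈⟨ *-cong refl (sym (B-as-row x y)) ⟩
    a * B x y                      ∎

  B-⊕ʳ : ∀ x y y' → B x (y ⊕ y') ≈ B x y + B x y'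
  B-⊕ʳ x y y' = trans (B-sym x (y ⊕ y')) (trans (B-⊕ˡ y y' x) (+-cong (B-sym y x) (B-sym y' x)))

  B-⊛ʳ : ∀ x a y → B x (a ⊛ y) ≈ a * B x y
  B-⊛ʳ x a y = trans (B-sym x (a ⊛ y)) (trans (B-⊛ˡ a y x) (*-cong refl (B-sym y x)))

  B-⊛⊕ˡ : ∀ a x w z → B (a ⊛ x ⊕ w) z ≈ a * B x z + B w z
  B-⊛⊕ˡ a x w z = trans (B-⊕ˡ (a ⊛ x) w z) (+-cong (B-⊛ˡ a x z) refl)

  B-⊛⊕ʳ : ∀ z a x w → B z (a ⊛ x ⊕ w) ≈ a * B z x + B z w
  B-⊛⊕ʳ z a x w = trans (B-⊕ʳ z (a ⊛ x) w) (+-cong (B-⊛ʳ z a x) refl)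

  B-⊕⊕ : ∀ x p y q → B (x ⊕ p) (y ⊕ q) ≈ B x y + (B x q + B p y + B p q)
  B-⊕⊕ x p y q = begin
    B (x ⊕ p) (y ⊕ q)                   ≈⟨ B-⊕ˡ x p (y ⊕ q) ⟩
    B x (y ⊕ q) + B p (y ⊕ q)           ≈⟨ +-cong (B-⊕ʳ x y q) (B-⊕ʳ p y q) ⟩
    (B x y + B x q) + (B p y + B p q)   ≈⟨ +-assoc _ _ _ ⟩
    B x y + (B x q + (B p y + B p q))   ≈⟨ +-cong refl (sym (+-assoc _ _ _)) ⟩
    B x y + (B x q + B p y + B p q)     ∎

  B-eʳ : ∀ x (k : Fin n) → B x (e (toℕ k)) ≈ sum (λ i → x i * S i k)
  B-eʳ x k = trans (B-as-row x (e (toℕ k))) (sum-cong (λ i → *-cong refl (sum-eʳ k (S i))))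

  B-e-e : ∀ (i k : Fin n) → B (e (toℕ i)) (e (toℕ k)) ≈ S i k
  B-e-e i k = trans (B-eʳ (e (toℕ i)) k) (sum-eˡ i (λ j → S j k))

  *-one-+-zero : ∀ {μ x y} → x ≈ 1# → y ≈ 0# → μ * x + y ≈ μ
  *-one-+-zero x≈1 y≈0 = trans (+-cong (trans (*-cong refl x≈1) (*-identityʳ _)) y≈0) (+-identityʳ _)

  *-zero-+ : ∀ {μ x y} → x ≈ 0# → μ * x + y ≈ y
  *-zero-+ x≈0 = trans (+-cong (trans (*-cong refl x≈0) (zeroʳ _)) refl) (+-identityˡ _)

  isotropic-⊛⊕ : ∀ {x w} μ → B x x ≈ 0# → B x w ≈ 0# → B w w ≈ 0# →
                 B (μ ⊛ x ⊕ w) (μ ⊛ x ⊕ w) ≈ 0#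
  isotropic-⊛⊕ {x} {w} μ xx xw ww = begin
    B (μ ⊛ x ⊕ w) (μ ⊛ x ⊕ w)
      ≈⟨ B-⊛⊕ˡ μ x w _ ⟩
    μ * B x (μ ⊛ x ⊕ w) + B w (μ ⊛ x ⊕ w)
      ≈⟨ +-cong (*-cong refl (B-⊛⊕ʳ x μ x w)) (B-⊛⊕ʳ w μ x w) ⟩
    μ * (μ * B x x + B x w) + (μ * B w x + B w w)
      ≈⟨ +-cong (*-cong refl (+-cong (*-cong refl xx) xw)) (+-cong (*-cong refl (trans (B-sym w x) xw)) ww) ⟩
    μ * (μ * 0# + 0#) + (μ * 0# + 0#)
      ≈⟨ solve 2 (λ m z → m :* (m :* z :+ z) :+ (m :* z :+ z) := (m :* m :+ m :+ m :+ con 1) :* z) refl μ 0# ⟩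
    (μ * μ + μ + μ + 1#) * 0#
      ≈⟨ zeroʳ _ ⟩
    0#
      ∎

  record IsLinear (F : V → V) : Set (c ⊔ ℓ) where
    field
      cong   : ∀ {x y} → x ≋ y → F x ≋ F y
      ⊕-homo : ∀ x y → F (x ⊕ y) ≋ F x ⊕ F y
      ⊛-homo : ∀ a x → F (a ⊛ x) ≋ a ⊛ F x

    0v-homo : F 0v ≋ 0v
    0v-homo k = begin
      F 0v k         ≈⟨ cong (λ _ → sym (zeroˡ 0#)) k ⟩
      F (0# ⊛ 0v) k  ≈⟨ ⊛-homo 0# 0v k ⟩
      0# * F 0v k    ≈⟨ zeroˡ _ ⟩
      0#             ∎

    vsum-homo : ∀ {m} (g : Fin m → V) → F (vsum g) ≋ vsum (λ j → F (g j))
    vsum-homo {zero}  g = 0v-homo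
    vsum-homo {suc m} g k = trans (⊕-homo (g Fin.zero) (vsum (λ j → g (Fin.suc j))) k)
                                  (+-cong refl (vsum-homo (λ j → g (Fin.suc j)) k))

    matrix : Fin n → Fin n → Carrier
    matrix j k = F (e (toℕ j)) k

    matrix-action : ∀ x k → sum (λ j → x j * matrix j k) ≈ F x k
    matrix-action x k = sym (begin
      F x k                               ≈⟨ cong (basis-expansion x) k ⟩
      F (vsum (λ j → x j ⊛ e (toℕ j))) k  ≈⟨ vsum-homo (λ j → x j ⊛ e (toℕ j)) k ⟩
      sum (λ j → F (x j ⊛ e (toℕ j)) k)   ≈⟨ sum-cong (λ j → ⊛-homo (x j) (e (toℕ j)) k) ⟩
      sum (λ j → x j * F (e (toℕ j)) k)   ∎)

  id-linear : IsLinear (λ x → x)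
  id-linear = record { cong = λ x≋y → x≋y ; ⊕-homo = λ _ _ → ≋-refl ; ⊛-homo = λ _ _ → ≋-refl }

  ∘-linear : ∀ {F G} → IsLinear F → IsLinear G → IsLinear (λ x → G (F x))
  ∘-linear {F} {G} F-lin G-lin = record
    { cong   = λ x≋y → G.cong (F.cong x≋y)
    ; ⊕-homo = λ x y k → trans (G.cong (F.⊕-homo x y) k) (G.⊕-homo (F x) (F y) k)
    ; ⊛-homo = λ a x k → trans (G.cong (F.⊛-homo a x) k) (G.⊛-homo a (F x) k)
    }
    where
    module F = IsLinear F-lin
    module G = IsLinear G-lin

  ⊕-linear : ∀ {F G} → IsLinear F → IsLinear G → IsLinear (λ x → F x ⊕ G x)
  ⊕-linear {F} {G} F-lin G-lin = record
    { cong   = λ x≋y k → +-cong (F.cong x≋y k) (G.cong x≋y k)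
    ; ⊕-homo = λ x y k → trans (+-cong (F.⊕-homo x y k) (G.⊕-homo x y k))
                           (solve 4 (λ a b a' b' → (a :+ b) :+ (a' :+ b') := (a :+ a') :+ (b :+ b')) refl _ _ _ _)
    ; ⊛-homo = λ a x k → trans (+-cong (F.⊛-homo a x k) (G.⊛-homo a x k)) (sym (distribˡ a _ _))
    }
    where
    module F = IsLinear F-lin
    module G = IsLinear G-lin

  rank-one-linear : ∀ a b → IsLinear (λ x → B x a ⊛ b)
  rank-one-linear a b = record
    { cong   = λ x≋y k → *-cong (B-cong x≋y ≋-refl) refl
    ; ⊕-homo = λ x y k → trans (*-cong (B-⊕ˡ x y a) refl) (distribʳ (b k) _ _)
    ; ⊛-homo = λ s x k → trans (*-cong (B-⊛ˡ s x a) refl) (*-assoc s _ _)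
    }

  record IsIsometry (F : V → V) : Set (c ⊔ ℓ) where
    field
      linear     : IsLinear F
      B-preserve : ∀ x y → B (F x) (F y) ≈ B x y

    open IsLinear linear public

    matrix-orthogonal : ∀ i k → sum (λ j → sum (λ l → matrix i j * S j l * matrix k l)) ≈ S i k
    matrix-orthogonal i k = trans (B-preserve (e (toℕ i)) (e (toℕ k))) (B-e-e i k)

  id-isometry : IsIsometry (λ x → x)
  id-isometry = record { linear = id-linear ; B-preserve = λ _ _ → refl }

  ∘-isometry : ∀ {F G} → IsIsometry F → IsIsometry G → IsIsometry (λ x → G (F x))
  ∘-isometry {F} {G} F-iso G-iso = record
    { linear     = ∘-linear F.linear G.linear
    ; B-preserve = λ x y → trans (G.B-preserve (F x) (F y)) (F.B-preserve x y)
    }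
    where
    module F = IsIsometry F-iso
    module G = IsIsometry G-iso

  -1# : Carrier
  -1# = - 1#

  -1#+1# : -1# + 1# ≈ 0#
  -1#+1# = trans (+-comm -1# 1#) (-‿inverseʳ 1#)

  *-1#-cancel : ∀ x → x * -1# + x ≈ 0#
  *-1#-cancel x = begin
    x * -1# + x        ≈⟨ +-cong refl (sym (*-identityʳ x)) ⟩
    x * -1# + x * 1#   ≈⟨ sym (distribˡ x -1# 1#) ⟩
    x * (-1# + 1#)     ≈⟨ *-cong refl -1#+1# ⟩
    x * 0#             ≈⟨ zeroʳ x ⟩
    0#                 ∎

  -1#*-1# : -1# * -1# ≈ 1#
  -1#*-1# = begin
    -1# * -1#                    ≈⟨ sym (+-identityʳ _) ⟩
    -1# * -1# + 0#               ≈⟨ +-cong refl (sym (*-1#-cancel 1#)) ⟩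
    -1# * -1# + (1# * -1# + 1#)  ≈⟨ solve 2 (λ m o → m :* m :+ (o :* m :+ o) := m :* (m :+ o) :+ o) refl -1# 1# ⟩
    -1# * (-1# + 1#) + 1#        ≈⟨ +-cong (*-cong refl -1#+1#) refl ⟩
    -1# * 0# + 1#                ≈⟨ trans (+-cong (zeroʳ -1#) refl) (+-identityˡ 1#) ⟩
    1#                           ∎

  -- c plays the role of −B(w,w)/2, so that no division by 2 is needed.
  eichler : V → V → Carrier → V → V
  eichler u w c x = x ⊕ (B x u ⊛ (w ⊕ c ⊛ u) ⊕ B x (-1# ⊛ w) ⊛ u)

  eichler-fixes : ∀ {u w} c x → B x u ≈ 0# → B x w ≈ 0# → eichler u w c x ≋ x
  eichler-fixes {u} {w} c x xu xw k = begin
    x k + (B x u * (w k + c * u k) + B x (-1# ⊛ w) * u k)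
      ≈⟨ +-cong refl (+-cong (*-cong xu refl) (*-cong (trans (B-⊛ʳ x -1# w) (*-cong refl xw)) refl)) ⟩
    x k + (0# * (w k + c * u k) + -1# * 0# * u k)
      ≈⟨ +-cong refl (+-cong (zeroˡ _) (trans (*-cong (zeroʳ -1#) refl) (zeroˡ _))) ⟩
    x k + (0# + 0#)
      ≈⟨ trans (+-cong refl (+-identityˡ 0#)) (+-identityʳ _) ⟩
    x k
      ∎

  eichler-isometry : ∀ {u w c} → B u u ≈ 0# → B w u ≈ 0# → B w w + (c + c) ≈ 0# → IsIsometry (eichler u w c)
  eichler-isometry {u} {w} {c} uu wu ww = record
    { linear     = ⊕-linear id-linear (⊕-linear (rank-one-linear u w') (rank-one-linear (-1# ⊛ w) u))
    ; B-preserve = preserve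
    }
    where
    w' : V
    w' = w ⊕ c ⊛ u
    A X : V → Carrier
    A x = B x u
    X x = B x w
    p : V → V
    p x = A x ⊛ w' ⊕ B x (-1# ⊛ w) ⊛ u

    B-w'ʳ : ∀ z → B z w' ≈ X z + c * A z
    B-w'ʳ z = trans (B-⊕ʳ z w (c ⊛ u)) (+-cong refl (B-⊛ʳ z c u))

    B-pˡ : ∀ x z → B (p x) z ≈ A x * B w' z + (-1# * X x) * B u z
    B-pˡ x z = trans (B-⊕ˡ _ _ z) (+-cong (B-⊛ˡ (A x) w' z) (trans (B-⊛ˡ _ u z) (*-cong (B-⊛ʳ x -1# w) refl)))

    B-pʳ : ∀ z y → B z (p y) ≈ A y * B z w' + (-1# * X y) * A z
    B-pʳ z y = trans (B-sym z (p y)) (trans (B-pˡ y z) (+-cong (*-cong refl (B-sym w' z)) (*-cong refl (B-sym u z))))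

    w'u : B w' u ≈ 0#
    w'u = trans (B-sym w' u) (trans (B-w'ʳ u) (trans (+-cong (trans (B-sym u w) wu) (*-cong refl uu))
                                                      (trans (+-identityˡ _) (zeroʳ c))))

    w'w' : B w' w' ≈ B w w
    w'w' = trans (B-w'ʳ w') (trans (+-cong (trans (B-sym w' w) (trans (B-w'ʳ w) (+-cong refl (*-cong refl wu))))
                                           (*-cong refl w'u))
                                   (trans (+-cong (trans (+-cong refl (zeroʳ c)) (+-identityʳ _)) (zeroʳ c))
                                          (+-identityʳ _)))

    B-p-p : ∀ x y → B (p x) (p y) ≈ A x * (A y * B w w + (-1# * X y) * 0#)
                                    + (-1# * X x) * (A y * 0# + (-1# * X y) * 0#)
    B-p-p x y = trans (B-pˡ x (p y))
                      (+-cong (*-cong refl (trans (B-pʳ w' y) (+-cong (*-cong refl w'w') (*-cong refl w'u))))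
                              (*-cong refl (trans (B-pʳ u y) (+-cong (*-cong refl (trans (B-sym u w') w'u))
                                                                     (*-cong refl uu)))))

    preserve : ∀ x y → B (eichler u w c x) (eichler u w c y) ≈ B x y
    preserve x y = begin
      B (x ⊕ p x) (y ⊕ p y)
        ≈⟨ B-⊕⊕ x (p x) y (p y) ⟩
      B x y + (B x (p y) + B (p x) y + B (p x) (p y))
        ≈⟨ +-cong refl (+-cong (+-cong (trans (B-pʳ x y) (+-cong (*-cong refl (B-w'ʳ x)) refl))
                                       (trans (B-pˡ x y) (+-cong (*-cong refl (trans (B-sym w' y) (B-w'ʳ y)))
                                                                 (*-cong refl (B-sym u y)))))
                               (B-p-p x y)) ⟩
      B x y + ((A y * (X x + c * A x) + (-1# * X y) * A x) + (A x * (X y + c * A y) + (-1# * X x) * A y)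
               + (A x * (A y * B w w + (-1# * X y) * 0#) + (-1# * X x) * (A y * 0# + (-1# * X y) * 0#)))
        ≈⟨ +-cong refl (solve 8 (λ Ax Ay Xx Xy c' m W z →
              (Ay :* (Xx :+ c' :* Ax) :+ (m :* Xy) :* Ax) :+ (Ax :* (Xy :+ c' :* Ay) :+ (m :* Xx) :* Ay)
                :+ (Ax :* (Ay :* W :+ (m :* Xy) :* z) :+ (m :* Xx) :* (Ay :* z :+ (m :* Xy) :* z))
              := (Ax :* Ay) :* (W :+ (c' :+ c')) :+ ((Ax :* Xy) :* m :+ Ax :* Xy) :+ ((Ay :* Xx) :* m :+ Ay :* Xx)
                   :+ (Ax :* m :* Xy :+ m :* Xx :* Ay :+ m :* Xx :* m :* Xy) :* z)
              refl (A x) (A y) (X x) (X y) c -1# (B w w) 0#) ⟩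
      B x y + ((A x * A y) * (B w w + (c + c)) + ((A x * X y) * -1# + A x * X y) + ((A y * X x) * -1# + A y * X x)
               + (A x * -1# * X y + -1# * X x * A y + -1# * X x * -1# * X y) * 0#)
        ≈⟨ +-cong refl (+-cong (+-cong (+-cong (trans (*-cong refl ww) (zeroʳ _)) (*-1#-cancel _)) (*-1#-cancel _))
                               (zeroʳ _)) ⟩
      B x y + (0# + 0# + 0# + 0#)
        ≈⟨ +-cong refl (trans (+-identityʳ _) (trans (+-identityʳ _) (+-identityʳ _))) ⟩
      B x y + 0#
        ≈⟨ +-identityʳ _ ⟩
      B x y
        ∎

  -- k plays the role of −2/B(r,r).
  reflection : V → Carrier → V → V
  reflection r k x = x ⊕ B x (k ⊛ r) ⊛ r

  reflection-fixes : ∀ {r} k x → B x r ≈ 0# → reflection r k x ≋ x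
  reflection-fixes {r} k x xr i = begin
    x i + B x (k ⊛ r) * r i  ≈⟨ +-cong refl (*-cong (trans (B-⊛ʳ x k r) (trans (*-cong refl xr) (zeroʳ k))) refl) ⟩
    x i + 0# * r i           ≈⟨ trans (+-cong refl (zeroˡ _)) (+-identityʳ _) ⟩
    x i                      ∎

  reflection-isometry : ∀ {r k} → k * B r r + (1# + 1#) ≈ 0# → IsIsometry (reflection r k)
  reflection-isometry {r} {k} krr = record
    { linear     = ⊕-linear id-linear (rank-one-linear (k ⊛ r) r)
    ; B-preserve = preserve
    }
    where
    preserve : ∀ x y → B (reflection r k x) (reflection r k y) ≈ B x y
    preserve x y = begin
      B (x ⊕ B x (k ⊛ r) ⊛ r) (y ⊕ B y (k ⊛ r) ⊛ r)
        ≈⟨ B-⊕⊕ x _ y _ ⟩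
      B x y + (B x (B y (k ⊛ r) ⊛ r) + B (B x (k ⊛ r) ⊛ r) y + B (B x (k ⊛ r) ⊛ r) (B y (k ⊛ r) ⊛ r))
        ≈⟨ +-cong refl (+-cong (+-cong (B-⊛ʳ x _ r) (B-⊛ˡ _ r y)) (trans (B-⊛ˡ _ r _) (*-cong refl (B-⊛ʳ r _ r)))) ⟩
      B x y + (B y (k ⊛ r) * B x r + B x (k ⊛ r) * B r y + B x (k ⊛ r) * (B y (k ⊛ r) * B r r))
        ≈⟨ +-cong refl (+-cong (+-cong (*-cong (B-⊛ʳ y k r) refl) (*-cong (B-⊛ʳ x k r) (B-sym r y)))
                                (*-cong (B-⊛ʳ x k r) (*-cong (B-⊛ʳ y k r) refl))) ⟩
      B x y + (k * B y r * B x r + k * B x r * B y r + k * B x r * (k * B y r * B r r))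
        ≈⟨ +-cong refl (solve 4 (λ k' X Y Q → k' :* Y :* X :+ k' :* X :* Y :+ k' :* X :* (k' :* Y :* Q)
                                              := (k' :* X :* Y) :* (k' :* Q :+ (con 1 :+ con 1)))
                                refl k (B x r) (B y r) (B r r)) ⟩
      B x y + (k * B x r * B y r) * (k * B r r + (1# + 1#))
        ≈⟨ +-cong refl (trans (*-cong refl krr) (zeroʳ _)) ⟩
      B x y + 0#
        ≈⟨ +-identityʳ _ ⟩
      B x y
        ∎

  record IsHyperbolicPair (x y : V) : Set ℓ where
    field
      isotropicˡ : B x x ≈ 0#
      isotropicʳ : B y y ≈ 0#
      pairing    : B x y ≈ 1#

  module Stabiliser (o : V) where

    infix 4 _⇝_

    _⇝_ : V → V → Set (c ⊔ ℓ)
    a ⇝ t = Σ (V → V) λ F → IsIsometry F × F o ≋ o × F a ≋ t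

    ⇝-refl : ∀ {a} → a ⇝ a
    ⇝-refl = (λ x → x) , id-isometry , ≋-refl , ≋-refl

    ⇝-trans : ∀ {a b t} → a ⇝ b → b ⇝ t → a ⇝ t
    ⇝-trans (F , F-iso , Fo≋o , Fa≋b) (G , G-iso , Go≋o , Gb≋t) =
      (λ x → G (F x)) , ∘-isometry F-iso G-iso ,
      (λ k → trans (G.cong Fo≋o k) (Go≋o k)) , (λ k → trans (G.cong Fa≋b k) (Gb≋t k))
      where module G = IsIsometry G-iso

    ⇝-≋ : ∀ {a t t'} → a ⇝ t → t ≋ t' → a ⇝ t'
    ⇝-≋ (F , F-iso , Fo≋o , Fa≋t) t≋t' = F , F-iso , Fo≋o , λ k → trans (Fa≋t k) (t≋t' k)

    -- The Eichler transformation along u with w = μ⁻¹(t − a) and c = μ⁻² B(t,a).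
    eichler-transitive : ∀ {a t u μ μ⁻¹} → μ * μ⁻¹ ≈ 1# →
                         B a a ≈ 0# → B t t ≈ 0# → B u u ≈ 0# → B a u ≈ μ → B t u ≈ μ →
                         B o u ≈ 0# → B o a ≈ B o t → a ⇝ t
    eichler-transitive {a} {t} {u} {μ} {μ⁻¹} μμ⁻¹ aa tt uu au tu ou oa =
      eichler u w κ , eichler-isometry uu wu ww , eichler-fixes κ o ou ow , moves
      where
      w : V
      w = μ⁻¹ ⊛ (t ⊕ -1# ⊛ a)
      T κ : Carrier
      T = B t a
      κ = T * μ⁻¹ * μ⁻¹

      B-wˡ : ∀ z → B w z ≈ μ⁻¹ * (B t z + -1# * B a z)
      B-wˡ z = trans (B-⊛ˡ μ⁻¹ _ z) (*-cong refl (trans (B-⊕ˡ t _ z) (+-cong refl (B-⊛ˡ -1# a z))))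

      B-wʳ : ∀ z → B z w ≈ μ⁻¹ * (B t z + -1# * B a z)
      B-wʳ z = trans (B-sym z w) (B-wˡ z)

      difference-cancel : ∀ x → x + -1# * x ≈ 0#
      difference-cancel x = trans (+-comm _ _) (trans (+-cong (*-comm -1# x) refl) (*-1#-cancel x))

      wu : B w u ≈ 0#
      wu = begin
        B w u                        ≈⟨ B-wˡ u ⟩
        μ⁻¹ * (B t u + -1# * B a u)  ≈⟨ *-cong refl (trans (+-cong tu (*-cong refl au)) (difference-cancel μ)) ⟩
        μ⁻¹ * 0#                     ≈⟨ zeroʳ μ⁻¹ ⟩
        0#                           ∎

      ow : B o w ≈ 0#
      ow = begin
        B o w                        ≈⟨ B-wʳ o ⟩
        μ⁻¹ * (B t o + -1# * B a o)  ≈⟨ *-cong refl (+-cong (B-sym t o) (*-cong refl (trans (B-sym a o) oa))) ⟩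
        μ⁻¹ * (B o t + -1# * B o t)  ≈⟨ *-cong refl (difference-cancel _) ⟩
        μ⁻¹ * 0#                     ≈⟨ zeroʳ μ⁻¹ ⟩
        0#                           ∎

      ww : B w w + (κ + κ) ≈ 0#
      ww = begin
        B w w + (κ + κ)
          ≈⟨ +-cong (trans (B-wˡ w) (*-cong refl (+-cong (B-wʳ t) (*-cong refl (B-wʳ a))))) refl ⟩
        μ⁻¹ * (μ⁻¹ * (B t t + -1# * B a t) + -1# * (μ⁻¹ * (B t a + -1# * B a a))) + (κ + κ)
          ≈⟨ +-cong (*-cong refl (+-cong (*-cong refl (+-cong tt (*-cong refl (B-sym a t))))
                                         (*-cong refl (*-cong refl (+-cong refl (*-cong refl aa)))))) refl ⟩
        μ⁻¹ * (μ⁻¹ * (0# + -1# * T) + -1# * (μ⁻¹ * (T + -1# * 0#))) + (T * μ⁻¹ * μ⁻¹ + T * μ⁻¹ * μ⁻¹)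
          ≈⟨ solve 4 (λ i m T' Z → i :* (i :* (Z :+ m :* T') :+ m :* (i :* (T' :+ m :* Z))) :+ (T' :* i :* i :+ T' :* i :* i)
                       := ((i :* i :* T') :* m :+ i :* i :* T') :+ ((i :* i :* T') :* m :+ i :* i :* T')
                          :+ (i :* i :+ i :* m :* i :* m) :* Z)
                     refl μ⁻¹ -1# T 0# ⟩
        ((μ⁻¹ * μ⁻¹ * T) * -1# + μ⁻¹ * μ⁻¹ * T) + ((μ⁻¹ * μ⁻¹ * T) * -1# + μ⁻¹ * μ⁻¹ * T)
          + (μ⁻¹ * μ⁻¹ + μ⁻¹ * -1# * μ⁻¹ * -1#) * 0#
          ≈⟨ +-cong (+-cong (*-1#-cancel _) (*-1#-cancel _)) (zeroʳ _) ⟩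
        (0# + 0#) + 0#
          ≈⟨ trans (+-identityʳ _) (+-identityʳ 0#) ⟩
        0#
          ∎

      μμ⁻¹-cancel : ∀ x → μ * μ⁻¹ * x ≈ x
      μμ⁻¹-cancel x = trans (*-cong μμ⁻¹ refl) (*-identityˡ x)

      a-w : B a (-1# ⊛ w) ≈ -1# * (μ⁻¹ * (T + -1# * 0#))
      a-w = trans (B-⊛ʳ a -1# w) (*-cong refl (trans (B-wʳ a) (*-cong refl (+-cong refl (*-cong refl aa)))))

      moves : eichler u w κ a ≋ t
      moves k = begin
        a k + (B a u * (w k + κ * u k) + B a (-1# ⊛ w) * u k)
          ≈⟨ +-cong refl (+-cong (*-cong au refl) (*-cong a-w refl)) ⟩
        a k + (μ * (μ⁻¹ * (t k + -1# * a k) + T * μ⁻¹ * μ⁻¹ * u k) + -1# * (μ⁻¹ * (T + -1# * 0#)) * u k)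
          ≈⟨ solve 8 (λ ak tk uk m' i T' m Z →
                ak :+ (m' :* (i :* (tk :+ m :* ak) :+ T' :* i :* i :* uk) :+ m :* (i :* (T' :+ m :* Z)) :* uk)
                := m' :* i :* tk :+ (((m' :* i :* ak) :* m :+ ak)
                   :+ (((i :* T' :* uk) :* m :+ m' :* i :* (i :* T' :* uk)) :+ (m :* m :* i :* uk) :* Z)))
              refl (a k) (t k) (u k) μ μ⁻¹ T -1# 0# ⟩
        μ * μ⁻¹ * t k + ((μ * μ⁻¹ * a k * -1# + a k)
                         + ((μ⁻¹ * T * u k * -1# + μ * μ⁻¹ * (μ⁻¹ * T * u k)) + (-1# * -1# * μ⁻¹ * u k) * 0#))
          ≈⟨ +-cong (μμ⁻¹-cancel (t k))
                    (+-cong (trans (+-cong (*-cong (μμ⁻¹-cancel (a k)) refl) refl) (*-1#-cancel (a k)))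
                            (+-cong (trans (+-cong refl (μμ⁻¹-cancel _)) (*-1#-cancel _)) (zeroʳ _))) ⟩
        t k + (0# + (0# + 0#))
          ≈⟨ trans (+-cong refl (trans (+-identityˡ _) (+-identityˡ 0#))) (+-identityʳ _) ⟩
        t k
          ∎

    record IsHyperbolicPair⊥ (w x y : V) : Set ℓ where
      field
        hyperbolic : IsHyperbolicPair x y
        o⊥x        : B o x ≈ 0#
        o⊥y        : B o y ≈ 0#
        w⊥x        : B w x ≈ 0#
        w⊥y        : B w y ≈ 0#

      open IsHyperbolicPair hyperbolic public

      B-⊛⊕-y : ∀ μ → B (μ ⊛ x ⊕ w) y ≈ μ
      B-⊛⊕-y μ = trans (B-⊛⊕ˡ μ x w y) (*-one-+-zero pairing w⊥y)

      B-o-⊛⊕ : ∀ μ → B o (μ ⊛ x ⊕ w) ≈ B o w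
      B-o-⊛⊕ μ = trans (B-⊛⊕ʳ o μ x w) (*-zero-+ o⊥x)

      ⊛⊕-isotropic : ∀ μ → B w w ≈ 0# → B (μ ⊛ x ⊕ w) (μ ⊛ x ⊕ w) ≈ 0#
      ⊛⊕-isotropic μ ww = isotropic-⊛⊕ μ isotropicˡ (trans (B-sym x w) w⊥x) ww

    hyperbolic⊥-swap : ∀ {w x y} → IsHyperbolicPair⊥ w x y → IsHyperbolicPair⊥ w y x
    hyperbolic⊥-swap P = record
      { hyperbolic = record { isotropicˡ = isotropicʳ ; isotropicʳ = isotropicˡ ; pairing = trans (B-sym _ _) pairing }
      ; o⊥x = o⊥y ; o⊥y = o⊥x ; w⊥x = w⊥y ; w⊥y = w⊥x
      }
      where open IsHyperbolicPair⊥ P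

    -- the reflection in r = x − κ y, for which B(r,r) = −2κ
    hyperbolic-flip : ∀ {w x y κ κ⁻¹} μ → IsHyperbolicPair⊥ w x y → κ * κ⁻¹ ≈ 1# →
                      μ ⊛ x ⊕ w ⇝ (κ * μ) ⊛ y ⊕ w
    hyperbolic-flip {w} {x} {y} {κ} {κ⁻¹} μ P κκ⁻¹ =
      reflection r κ⁻¹ , reflection-isometry rr , reflection-fixes κ⁻¹ o (B-⊥-r o⊥y o⊥x) , moves
      where
      open IsHyperbolicPair⊥ P
      d : Carrier
      d = -1# * κ
      r : V
      r = d ⊛ y ⊕ x

      B-⊥-r : ∀ {z} → B z y ≈ 0# → B z x ≈ 0# → B z r ≈ 0#
      B-⊥-r zy zx = trans (B-⊛⊕ʳ _ d y x) (trans (*-zero-+ zy) zx)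

      xr : B x r ≈ d
      xr = trans (B-⊛⊕ʳ x d y x) (*-one-+-zero pairing isotropicˡ)

      yr : B y r ≈ 1#
      yr = trans (B-⊛⊕ʳ y d y x) (trans (*-zero-+ isotropicʳ) (trans (B-sym y x) pairing))

      κκ⁻¹-1 : (κ * κ⁻¹) * -1# + 1# ≈ 0#
      κκ⁻¹-1 = trans (+-cong (trans (*-cong κκ⁻¹ refl) (*-identityˡ -1#)) refl) -1#+1#

      rr : κ⁻¹ * B r r + (1# + 1#) ≈ 0#
      rr = begin
        κ⁻¹ * B r r + (1# + 1#)
          ≈⟨ +-cong (*-cong refl (trans (B-⊛⊕ˡ d y x r) (+-cong (*-cong refl yr) xr))) refl ⟩
        κ⁻¹ * (-1# * κ * 1# + -1# * κ) + (1# + 1#)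
          ≈⟨ solve 3 (λ l i m → i :* (m :* l :* con 1 :+ m :* l) :+ (con 1 :+ con 1)
                       := ((l :* i) :* m :+ con 1) :+ ((l :* i) :* m :+ con 1)) refl κ κ⁻¹ -1# ⟩
        ((κ * κ⁻¹) * -1# + 1#) + ((κ * κ⁻¹) * -1# + 1#)
          ≈⟨ trans (+-cong κκ⁻¹-1 κκ⁻¹-1) (+-identityʳ 0#) ⟩
        0#
          ∎

      coefficient : B (μ ⊛ x ⊕ w) (κ⁻¹ ⊛ r) ≈ -1# * μ
      coefficient = begin
        B (μ ⊛ x ⊕ w) (κ⁻¹ ⊛ r)            ≈⟨ trans (B-⊛ʳ _ κ⁻¹ r) (*-cong refl (B-⊛⊕ˡ μ x w r)) ⟩
        κ⁻¹ * (μ * B x r + B w r)          ≈⟨ *-cong refl (+-cong (*-cong refl xr) (B-⊥-r w⊥y w⊥x)) ⟩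
        κ⁻¹ * (μ * (-1# * κ) + 0#)         ≈⟨ solve 5 (λ i m' m l z → i :* (m' :* (m :* l) :+ z)
                                                               := (l :* i) :* (m :* m') :+ i :* z)
                                                       refl κ⁻¹ μ -1# κ 0# ⟩
        (κ * κ⁻¹) * (-1# * μ) + κ⁻¹ * 0#   ≈⟨ trans (+-cong (trans (*-cong κκ⁻¹ refl) (*-identityˡ _)) (zeroʳ κ⁻¹))
                                                    (+-identityʳ _) ⟩
        -1# * μ                            ∎

      moves : reflection r κ⁻¹ (μ ⊛ x ⊕ w) ≋ (κ * μ) ⊛ y ⊕ w
      moves k = begin
        (μ * x k + w k) + B (μ ⊛ x ⊕ w) (κ⁻¹ ⊛ r) * (-1# * κ * y k + x k)
          ≈⟨ +-cong refl (*-cong coefficient refl) ⟩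
        (μ * x k + w k) + -1# * μ * (-1# * κ * y k + x k)
          ≈⟨ solve 6 (λ m' xk wk m l yk → (m' :* xk :+ wk) :+ m :* m' :* (m :* l :* yk :+ xk)
                       := (m :* m) :* (l :* m' :* yk) :+ wk :+ ((m' :* xk) :* m :+ m' :* xk))
                     refl μ (x k) (w k) -1# κ (y k) ⟩
        (-1# * -1#) * (κ * μ * y k) + w k + ((μ * x k) * -1# + μ * x k)
          ≈⟨ trans (+-cong (+-cong (trans (*-cong -1#*-1# refl) (*-identityˡ _)) refl) (*-1#-cancel _)) (+-identityʳ _) ⟩
        κ * μ * y k + w k
          ∎

    hyperbolic-rescale : ∀ {w x y κ κ⁻¹} μ → IsHyperbolicPair⊥ w x y → κ * κ⁻¹ ≈ 1# →
                         μ ⊛ x ⊕ w ⇝ (κ * μ) ⊛ x ⊕ w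
    hyperbolic-rescale {κ = κ} μ P κκ⁻¹ =
      ⇝-≋ (⇝-trans (hyperbolic-flip μ P κκ⁻¹) (hyperbolic-flip (κ * μ) (hyperbolic⊥-swap P) (*-identityˡ 1#)))
          (λ k → +-cong (*-cong (*-identityˡ _) refl) refl)

    hyperbolic-normal-form : ∀ {w x y a μ μ⁻¹} → IsHyperbolicPair⊥ w x y → B w w ≈ 0# →
                             B a a ≈ 0# → B o a ≈ B o w → B a y ≈ μ → μ * μ⁻¹ ≈ 1# → a ⇝ μ ⊛ x ⊕ w
    hyperbolic-normal-form {μ = μ} P ww aa oa ay μμ⁻¹ =
      eichler-transitive μμ⁻¹ aa (⊛⊕-isotropic μ ww) isotropicʳ ay (B-⊛⊕-y μ) o⊥y (trans oa (sym (B-o-⊛⊕ μ)))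
      where open IsHyperbolicPair⊥ P

    -- an Eichler transformation along y + y'
    hyperbolic-exchange : ∀ {w x y x' y' μ μ⁻¹} → IsHyperbolicPair⊥ w x y → IsHyperbolicPair⊥ w x' y' →
                          B x y' ≈ 0# → B x' y ≈ 0# → B y y' ≈ 0# → B w w ≈ 0# → μ * μ⁻¹ ≈ 1# →
                          μ ⊛ x ⊕ w ⇝ μ ⊛ x' ⊕ w
    hyperbolic-exchange {w} {x} {y} {x'} {y'} {μ} P P' xy' x'y yy' ww μμ⁻¹ =
      eichler-transitive μμ⁻¹ (P.⊛⊕-isotropic μ ww) (P'.⊛⊕-isotropic μ ww) uu tu t'u
                         (trans (B-⊕ʳ o y y') (trans (+-cong P.o⊥y P'.o⊥y) (+-identityʳ 0#)))
                         (trans (P.B-o-⊛⊕ μ) (sym (P'.B-o-⊛⊕ μ)))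
      where
      module P = IsHyperbolicPair⊥ P
      module P' = IsHyperbolicPair⊥ P'

      uu : B (y ⊕ y') (y ⊕ y') ≈ 0#
      uu = begin
        B (y ⊕ y') (y ⊕ y')                  ≈⟨ B-⊕⊕ y y' y y' ⟩
        B y y + (B y y' + B y' y + B y' y')  ≈⟨ +-cong P.isotropicʳ (+-cong (+-cong yy' (trans (B-sym y' y) yy'))
                                                                            P'.isotropicʳ) ⟩
        0# + (0# + 0# + 0#)                  ≈⟨ trans (+-identityˡ _) (trans (+-identityʳ _) (+-identityʳ 0#)) ⟩
        0#                                   ∎

      tu : B (μ ⊛ x ⊕ w) (y ⊕ y') ≈ μ
      tu = trans (B-⊕ʳ _ y y') (trans (+-cong (P.B-⊛⊕-y μ) (trans (B-⊛⊕ˡ μ x w y') (trans (*-zero-+ xy') P'.w⊥y)))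
                                      (+-identityʳ μ))

      t'u : B (μ ⊛ x' ⊕ w) (y ⊕ y') ≈ μ
      t'u = trans (B-⊕ʳ _ y y') (trans (+-cong (trans (B-⊛⊕ˡ μ x' w y) (trans (*-zero-+ x'y) P.w⊥y)) (P'.B-⊛⊕-y μ))
                                       (+-identityˡ μ))

module Hyperbolic {c ℓ} (R : CommutativeRing c ℓ) (ν δ : ℕ) (z : CommutativeRing.Carrier R) (b : Bool)
                  (0<ν : 0 < ν) where
  open CommutativeRing R
  open RingDefs R
  open Orth ν δ z b
  open Sums R

  N : ℕ
  N = ν ℕ.+ ν ℕ.+ δ

  kδ-sym : ∀ i j → kδ i j ≡ kδ j i
  kδ-sym i j = if-≡ᵇ-sym (toℕ i) (toℕ j)

  S-hyp-sym : ∀ x y → S-hyp x y ≡ S-hyp y x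
  S-hyp-sym (inj₁ i) (inj₁ j) = ≡.refl
  S-hyp-sym (inj₁ i) (inj₂ j) = kδ-sym i j
  S-hyp-sym (inj₂ i) (inj₁ j) = kδ-sym i j
  S-hyp-sym (inj₂ i) (inj₂ j) = ≡.refl

  Δmat-sym : ∀ d i j → Δmat d i j ≡ Δmat d j i
  Δmat-sym 1 Fin.zero Fin.zero                       = ≡.refl
  Δmat-sym 2 Fin.zero Fin.zero                       = ≡.refl
  Δmat-sym 2 Fin.zero (Fin.suc Fin.zero)             = ≡.refl
  Δmat-sym 2 (Fin.suc Fin.zero) Fin.zero             = ≡.refl
  Δmat-sym 2 (Fin.suc Fin.zero) (Fin.suc Fin.zero)   = ≡.refl
  Δmat-sym (suc (suc (suc d))) i j                   = ≡.refl

  S-blk-sym : ∀ x y → S-blk x y ≡ S-blk y x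
  S-blk-sym (inj₁ i) (inj₁ j) = S-hyp-sym (splitAt ν i) (splitAt ν j)
  S-blk-sym (inj₁ i) (inj₂ j) = ≡.refl
  S-blk-sym (inj₂ i) (inj₁ j) = ≡.refl
  S-blk-sym (inj₂ i) (inj₂ j) = Δmat-sym δ i j

  S-sym : ∀ i j → S i j ≡ S j i
  S-sym i j = S-blk-sym (splitAt (ν ℕ.+ ν) i) (splitAt (ν ℕ.+ ν) j)

  open Bilinear R S (λ i j → reflexive (S-sym i j)) public
  open Stabiliser (e 0) public
  open import Relation.Binary.Reasoning.Setoid setoid
  open import Algebra.Solver.Ring.NaturalCoefficients.Default commutativeSemiring

  low : ∀ {j} → j < ν → Fin N
  low j<ν = (fromℕ< j<ν ↑ˡ ν) ↑ˡ δ

  high : ∀ {j} → j < ν → Fin N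
  high j<ν = (ν ↑ʳ fromℕ< j<ν) ↑ˡ δ

  toℕ-low : ∀ {j} (j<ν : j < ν) → toℕ (low j<ν) ≡ j
  toℕ-low j<ν = ≡.trans (Finₚ.toℕ-↑ˡ _ δ) (≡.trans (Finₚ.toℕ-↑ˡ _ ν) (Finₚ.toℕ-fromℕ< j<ν))

  toℕ-high : ∀ {j} (j<ν : j < ν) → toℕ (high j<ν) ≡ ν ℕ.+ j
  toℕ-high j<ν = ≡.trans (Finₚ.toℕ-↑ˡ _ δ) (≡.trans (Finₚ.toℕ-↑ʳ ν _) (≡.cong (ν ℕ.+_) (Finₚ.toℕ-fromℕ< j<ν)))

  e-below : ∀ {k} (i : Fin N) → toℕ i < k → e k i ≡ 0#
  e-below i i<k = e-other i (ℕₚ.<⇒≢ i<k)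

  e-above : ∀ {k} (i : Fin N) → k < toℕ i → e k i ≡ 0#
  e-above i k<i = e-other i (λ i≡k → ℕₚ.<⇒≢ k<i (≡.sym i≡k))

  kδ≡e : ∀ a {j} (j<ν : j < ν) (i : Fin N) m → toℕ i ≡ m ℕ.+ toℕ a → kδ a (fromℕ< j<ν) ≡ e (m ℕ.+ j) i
  kδ≡e a {j} j<ν i m i≡m+a with toℕ a ℕ.≟ j
  ... | yes a≡j = ≡.trans (if-≡ᵇ-yes (≡.trans a≡j (≡.sym (Finₚ.toℕ-fromℕ< j<ν))))
                          (≡.sym (e-same i (≡.trans i≡m+a (≡.cong (m ℕ.+_) a≡j))))
  ... | no  a≢j = ≡.trans (if-≡ᵇ-no (λ a≡J → a≢j (≡.trans a≡J (Finₚ.toℕ-fromℕ< j<ν))))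
                          (≡.sym (e-other i (λ i≡m+j → a≢j (ℕₚ.+-cancelˡ-≡ m _ _ (≡.trans (≡.sym i≡m+a) i≡m+j)))))

  S-low : ∀ {j} (j<ν : j < ν) i → S i (low j<ν) ≡ e (ν ℕ.+ j) i
  S-low {j} j<ν i rewrite Finₚ.splitAt-↑ˡ (ν ℕ.+ ν) (fromℕ< j<ν ↑ˡ ν) δ with splitAt (ν ℕ.+ ν) i in eq
  ... | inj₂ d = ≡.sym (e-above i (≡.subst (ν ℕ.+ j <_) (≡.sym (toℕ-splitAt-inj₂ eq))
                                           (ℕₚ.<-≤-trans (ℕₚ.+-monoʳ-< ν j<ν) (ℕₚ.m≤m+n (ν ℕ.+ ν) (toℕ d)))))
  ... | inj₁ i' rewrite Finₚ.splitAt-↑ˡ ν (fromℕ< j<ν) ν with splitAt ν i' in eq'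
  ...   | inj₁ a = ≡.sym (e-below i (≡.subst (_< ν ℕ.+ j)
                                             (≡.sym (≡.trans (toℕ-splitAt-inj₁ eq) (toℕ-splitAt-inj₁ eq')))
                                             (ℕₚ.<-≤-trans (Finₚ.toℕ<n a) (ℕₚ.m≤m+n ν j))))
  ...   | inj₂ a = kδ≡e a j<ν i ν (≡.trans (toℕ-splitAt-inj₁ eq) (toℕ-splitAt-inj₂ eq'))

  S-high : ∀ {j} (j<ν : j < ν) i → S i (high j<ν) ≡ e j i
  S-high {j} j<ν i rewrite Finₚ.splitAt-↑ˡ (ν ℕ.+ ν) (ν ↑ʳ fromℕ< j<ν) δ with splitAt (ν ℕ.+ ν) i in eq
  ... | inj₂ d = ≡.sym (e-above i (≡.subst (j <_) (≡.sym (toℕ-splitAt-inj₂ eq))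
                                           (ℕₚ.<-≤-trans j<ν (ℕₚ.≤-trans (ℕₚ.m≤m+n ν ν) (ℕₚ.m≤m+n (ν ℕ.+ ν) (toℕ d))))))
  ... | inj₁ i' rewrite Finₚ.splitAt-↑ʳ ν ν (fromℕ< j<ν) with splitAt ν i' in eq'
  ...   | inj₂ a = ≡.sym (e-above i (≡.subst (j <_)
                                             (≡.sym (≡.trans (toℕ-splitAt-inj₁ eq) (toℕ-splitAt-inj₂ eq')))
                                             (ℕₚ.<-≤-trans j<ν (ℕₚ.m≤m+n ν (toℕ a)))))
  ...   | inj₁ a = kδ≡e a j<ν i 0 (≡.trans (toℕ-splitAt-inj₁ eq) (toℕ-splitAt-inj₁ eq'))

  B-e-low : ∀ {j} (j<ν : j < ν) x → B x (e j) ≈ x (high j<ν)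
  B-e-low {j} j<ν x = begin
    B x (e j)                               ≡⟨ ≡.cong (λ k → B x (e k)) (≡.sym (toℕ-low j<ν)) ⟩
    B x (e (toℕ (low j<ν)))                 ≈⟨ B-eʳ x (low j<ν) ⟩
    sum (λ i → x i * S i (low j<ν))         ≈⟨ sum-cong (λ i → *-cong refl (reflexive (S-low j<ν i))) ⟩
    sum (λ i → x i * e (ν ℕ.+ j) i)         ≡⟨ ≡.cong (λ k → sum (λ i → x i * e k i)) (≡.sym (toℕ-high j<ν)) ⟩
    sum (λ i → x i * e (toℕ (high j<ν)) i)  ≈⟨ sum-eʳ (high j<ν) x ⟩
    x (high j<ν)                            ∎

  B-e-high : ∀ {j} (j<ν : j < ν) x → B x (e (ν ℕ.+ j)) ≈ x (low j<ν)
  B-e-high {j} j<ν x = begin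
    B x (e (ν ℕ.+ j))                       ≡⟨ ≡.cong (λ k → B x (e k)) (≡.sym (toℕ-high j<ν)) ⟩
    B x (e (toℕ (high j<ν)))                ≈⟨ B-eʳ x (high j<ν) ⟩
    sum (λ i → x i * S i (high j<ν))        ≈⟨ sum-cong (λ i → *-cong refl (reflexive (S-high j<ν i))) ⟩
    sum (λ i → x i * e j i)                 ≡⟨ ≡.cong (λ k → sum (λ i → x i * e k i)) (≡.sym (toℕ-low j<ν)) ⟩
    sum (λ i → x i * e (toℕ (low j<ν)) i)   ≈⟨ sum-eʳ (low j<ν) x ⟩
    x (low j<ν)                             ∎

  B-low-low : ∀ {j k} → j < ν → k < ν → B (e j) (e k) ≈ 0#
  B-low-low j<ν k<ν = trans (B-e-low k<ν (e _))
    (reflexive (e-above (high k<ν) (≡.subst (_ <_) (≡.sym (toℕ-high k<ν)) (ℕₚ.<-≤-trans j<ν (ℕₚ.m≤m+n ν _)))))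

  B-high-high : ∀ {j k} → j < ν → k < ν → B (e (ν ℕ.+ j)) (e (ν ℕ.+ k)) ≈ 0#
  B-high-high j<ν k<ν = trans (B-e-high k<ν (e _))
    (reflexive (e-below (low k<ν) (≡.subst (_< _) (≡.sym (toℕ-low k<ν)) (ℕₚ.<-≤-trans k<ν (ℕₚ.m≤m+n ν _)))))

  B-low-high : ∀ {j} → j < ν → B (e j) (e (ν ℕ.+ j)) ≈ 1#
  B-low-high j<ν = trans (B-e-high j<ν (e _)) (reflexive (e-same (low j<ν) (toℕ-low j<ν)))

  B-low-high-≢ : ∀ {j k} → j ≢ k → k < ν → B (e j) (e (ν ℕ.+ k)) ≈ 0#
  B-low-high-≢ j≢k k<ν = trans (B-e-high k<ν (e _))
    (reflexive (e-other (low k<ν) (λ k≡j → j≢k (≡.trans (≡.sym k≡j) (toℕ-low k<ν)))))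

  e-ν : e {N} ν ≡ e (ν ℕ.+ 0)
  e-ν = ≡.cong e (≡.sym (ℕₚ.+-identityʳ ν))

  B-e₀-e-ν : B (e 0) (e ν) ≈ 1#
  B-e₀-e-ν = ≡.subst (λ y → B (e 0) y ≈ 1#) (≡.sym e-ν) (B-low-high 0<ν)

  B-e-ν-e-ν : B (e ν) (e ν) ≈ 0#
  B-e-ν-e-ν = ≡.subst (λ y → B y y ≈ 0#) (≡.sym e-ν) (B-high-high 0<ν 0<ν)

  B-e-ν-low : ∀ {j} → j ≢ 0 → j < ν → B (e ν) (e j) ≈ 0#
  B-e-ν-low {j} j≢0 j<ν =
    trans (B-sym (e ν) (e j)) (≡.subst (λ y → B (e j) y ≈ 0#) (≡.sym e-ν) (B-low-high-≢ j≢0 0<ν))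

  B-e-ν-high : ∀ {j} → j < ν → B (e ν) (e (ν ℕ.+ j)) ≈ 0#
  B-e-ν-high {j} j<ν = ≡.subst (λ y → B y (e (ν ℕ.+ j)) ≈ 0#) (≡.sym e-ν) (B-high-high 0<ν j<ν)

  ⊛-e-ν-isotropic : ∀ β → B (β ⊛ e ν) (β ⊛ e ν) ≈ 0#
  ⊛-e-ν-isotropic β = begin
    B (β ⊛ e ν) (β ⊛ e ν)  ≈⟨ trans (B-⊛ˡ β (e ν) _) (*-cong refl (B-⊛ʳ (e ν) β (e ν))) ⟩
    β * (β * B (e ν) (e ν)) ≈⟨ *-cong refl (*-cong refl B-e-ν-e-ν) ⟩
    β * (β * 0#)           ≈⟨ trans (*-cong refl (zeroʳ β)) (zeroʳ β) ⟩
    0#                     ∎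

  B-e₀-⊛-e-ν : ∀ β → B (e 0) (β ⊛ e ν) ≈ β
  B-e₀-⊛-e-ν β = trans (B-⊛ʳ (e 0) β (e ν)) (trans (*-cong refl B-e₀-e-ν) (*-identityʳ β))

  pair⊥ : ∀ β {j} → j ≢ 0 → j < ν → IsHyperbolicPair⊥ (β ⊛ e ν) (e j) (e (ν ℕ.+ j))
  pair⊥ β j≢0 j<ν = record
    { hyperbolic = record
      { isotropicˡ = B-low-low j<ν j<ν ; isotropicʳ = B-high-high j<ν j<ν ; pairing = B-low-high j<ν }
    ; o⊥x = B-low-low 0<ν j<ν
    ; o⊥y = B-low-high-≢ (j≢0 ∘ ≡.sym) j<ν
    ; w⊥x = trans (B-⊛ˡ β (e ν) _) (trans (*-cong refl (B-e-ν-low j≢0 j<ν)) (zeroʳ β))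
    ; w⊥y = trans (B-⊛ˡ β (e ν) _) (trans (*-cong refl (B-e-ν-high j<ν)) (zeroʳ β))
    }

  reach-e-ν : ∀ {a μ μ⁻¹} → B a a ≈ 0# → B (e 0) a ≈ μ → μ * μ⁻¹ ≈ 1# → a ⇝ μ ⊛ e ν
  reach-e-ν {a} {μ} aa e₀a μμ⁻¹ =
    eichler-transitive μμ⁻¹ aa (⊛-e-ν-isotropic μ) (B-low-low 0<ν 0<ν) (trans (B-sym a (e 0)) e₀a)
                       (trans (B-sym _ (e 0)) (B-e₀-⊛-e-ν μ)) (B-low-low 0<ν 0<ν) (trans e₀a (sym (B-e₀-⊛-e-ν μ)))

  HasUnitInPair : V → ℕ → Set (c ⊔ ℓ)
  HasUnitInPair a j = Unit (B a (e (ν ℕ.+ j))) ⊎ Unit (B a (e j))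

  reach-pair : ∀ {a J} → B a a ≈ 0# → J ≢ 0 → J < ν → HasUnitInPair a J →
               Σ Carrier λ μ → Unit μ × a ⇝ μ ⊛ e J ⊕ B (e 0) a ⊛ e ν
  reach-pair {a} aa J≢0 J<ν (inj₁ (μ⁻¹ , μμ⁻¹)) =
    _ , (μ⁻¹ , μμ⁻¹) ,
    hyperbolic-normal-form (pair⊥ _ J≢0 J<ν) (⊛-e-ν-isotropic _) aa (sym (B-e₀-⊛-e-ν _)) refl μμ⁻¹
  reach-pair {a} aa J≢0 J<ν (inj₂ (μ⁻¹ , μμ⁻¹)) =
    _ , (μ⁻¹ , μμ⁻¹) ,
    ⇝-≋ (⇝-trans (hyperbolic-normal-form P (⊛-e-ν-isotropic _) aa (sym (B-e₀-⊛-e-ν _)) refl μμ⁻¹)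
                 (hyperbolic-flip _ P (*-identityˡ 1#)))
        (λ k → +-cong (*-cong (*-identityˡ _) refl) refl)
    where
    P = hyperbolic⊥-swap (pair⊥ (B (e 0) a) J≢0 J<ν)

  move-to-pair₁ : 1 < ν → ∀ β {J μ} → J ≢ 0 → J < ν → Unit μ → μ ⊛ e J ⊕ β ⊛ e ν ⇝ μ ⊛ e 1 ⊕ β ⊛ e ν
  move-to-pair₁ 1<ν β {J} J≢0 J<ν (μ⁻¹ , μμ⁻¹) with J ℕ.≟ 1
  ... | yes ≡.refl = ⇝-refl
  ... | no  J≢1    = hyperbolic-exchange (pair⊥ β J≢0 J<ν) (pair⊥ β (λ ()) 1<ν)
                                         (B-low-high-≢ J≢1 1<ν) (B-low-high-≢ (J≢1 ∘ ≡.sym) J<ν) (B-high-high J<ν 1<ν)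
                                         (⊛-e-ν-isotropic β) μμ⁻¹

  reach-normal-form : 1 < ν → ∀ {a J} → B a a ≈ 0# → J ≢ 0 → J < ν → HasUnitInPair a J →
                      ∀ {v} → Unit v → a ⇝ v ⊛ e 1 ⊕ B (e 0) a ⊛ e ν
  reach-normal-form 1<ν {a} aa J≢0 J<ν unit {v} (v⁻¹ , vv⁻¹) with reach-pair aa J≢0 J<ν unit
  ... | μ , (μ⁻¹ , μμ⁻¹) , a⇝μe_J =
    ⇝-≋ (⇝-trans a⇝μe_J (⇝-trans (move-to-pair₁ 1<ν _ J≢0 J<ν (μ⁻¹ , μμ⁻¹))
                                 (hyperbolic-rescale μ (pair⊥ _ (λ ()) 1<ν) κκ⁻¹)))
        (λ k → +-cong (*-cong κμ refl) refl)
    where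
    κκ⁻¹ : (v * μ⁻¹) * (μ * v⁻¹) ≈ 1#
    κκ⁻¹ = begin
      (v * μ⁻¹) * (μ * v⁻¹)  ≈⟨ solve 4 (λ x x⁻¹ y y⁻¹ → (x :* y⁻¹) :* (y :* x⁻¹) := (y :* y⁻¹) :* (x :* x⁻¹))
                                        refl v v⁻¹ μ μ⁻¹ ⟩
      (μ * μ⁻¹) * (v * v⁻¹)  ≈⟨ *-cong μμ⁻¹ vv⁻¹ ⟩
      1# * 1#                ≈⟨ *-identityˡ 1# ⟩
      1#                     ∎
    κμ : v * μ⁻¹ * μ ≈ v
    κμ = trans (*-assoc v μ⁻¹ μ) (trans (*-cong refl (trans (*-comm μ⁻¹ μ) μμ⁻¹)) (*-identityʳ v))

  ⇝-carries : ∀ {a t u} → a ⇝ u ⊛ t → Unit u → Carries a t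
  ⇝-carries {a} (F , F-iso , Fo≋o , Fa≋ut) u-unit =
    matrix , (matrix-orthogonal , 1# , (1# , *-identityˡ 1#) , fixes-e₀) ,
    _ , u-unit , λ k → trans (matrix-action a k) (Fa≋ut k)
    where
    open IsIsometry F-iso
    fixes-e₀ : ∀ k → sum (λ j → e 0 j * matrix j k) ≈ 1# * e 0 k
    fixes-e₀ k = trans (matrix-action (e 0) k) (trans (Fo≋o k) (sym (*-identityˡ _)))

  carries-≋ : ∀ {a t t'} → Carries a t → t ≋ t' → Carries a t'
  carries-≋ (T , T-stab , u , u-unit , aT≈ut) t≋t' =
    T , T-stab , u , u-unit , λ k → trans (aT≈ut k) (*-cong refl (t≋t' k))

  carries-normal-form : 1 < ν → ∀ {a J} → B a a ≈ 0# → J ≢ 0 → J < ν → HasUnitInPair a J →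
                        ∀ {π v} → Unit v → B (e 0) a ≈ π * v → Carries a (e 1 ⊕ π ⊛ e ν)
  carries-normal-form 1<ν {a} aa J≢0 J<ν unit {π} {v} v-unit e₀a≈πv =
    ⇝-carries (⇝-≋ (reach-normal-form 1<ν aa J≢0 J<ν unit v-unit) factor) v-unit
    where
    factor : v ⊛ e 1 ⊕ B (e 0) a ⊛ e ν ≋ v ⊛ (e 1 ⊕ π ⊛ e ν)
    factor k = trans (+-cong refl (*-cong e₀a≈πv refl))
                     (solve 4 (λ v' x π' y → v' :* x :+ π' :* v' :* y := v' :* (x :+ π' :* y)) refl v (e 1 k) π (e ν k))

  unit-resp : ∀ {x y} → x ≈ y → Unit x → Unit y
  unit-resp x≈y (x⁻¹ , xx⁻¹) = x⁻¹ , trans (*-cong (sym x≈y) refl) xx⁻¹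

  coordinate : ∀ (a : V) {i' i} → toℕ i' ≡ toℕ i → a i' ≈ a i
  coordinate a eq = reflexive (≡.cong a (Finₚ.toℕ-injective eq))

  unit-coordinate : ∀ a (i : Fin N) → 1 ≤ toℕ i → toℕ i < 2 ℕ.* ν → Unit (a i) →
                    Unit (B (e 0) a) ⊎ ∃[ J ] (J ≢ 0 × J < ν × HasUnitInPair a J)
  unit-coordinate a i 1≤i i<2ν a-unit with ℕₚ.<-cmp (toℕ i) ν
  ... | tri< i<ν _ _ = inj₂ (toℕ i , ℕₚ.m<n⇒n≢0 1≤i , i<ν ,
                             inj₁ (unit-resp (sym (trans (B-e-high i<ν a) (coordinate a (toℕ-low i<ν)))) a-unit))
  ... | tri≈ _ i≡ν _ =
    inj₁ (unit-resp (sym (trans (B-sym (e 0) a) (trans (B-e-low 0<ν a) (coordinate a high₀≡i)))) a-unit)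
    where
    high₀≡i : toℕ (high 0<ν) ≡ toℕ i
    high₀≡i = ≡.trans (toℕ-high 0<ν) (≡.trans (ℕₚ.+-identityʳ ν) (≡.sym i≡ν))
  ... | tri> _ _ ν<i = inj₂ (J , ℕₚ.m<n⇒n≢0 (ℕₚ.m<n⇒0<n∸m ν<i) , J<ν ,
                             inj₂ (unit-resp (sym (trans (B-e-low J<ν a) (coordinate a (≡.trans (toℕ-high J<ν) ν+J≡i))))
                                             a-unit))
    where
    J = toℕ i ℕ.∸ ν
    ν+J≡i : ν ℕ.+ J ≡ toℕ i
    ν+J≡i = ℕₚ.m+[n∸m]≡n (ℕₚ.<⇒≤ ν<i)
    J<ν : J < ν
    J<ν = ℕₚ.+-cancelˡ-< ν J ν (≡.subst₂ _<_ (≡.sym ν+J≡i) (≡.cong (ν ℕ.+_) (ℕₚ.+-identityʳ ν)) i<2ν)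

module GaloisRing {c ℓ} (R : CommutativeRing c ℓ) {p s m : ℕ} (G : RingDefs.IsGaloisRing R p s m) where
  open CommutativeRing R
  open RingDefs R
  open IsGaloisRing G
  import Algebra.Properties.Semiring.Mult semiring as Mult
  open import Relation.Binary.Reasoning.Setoid setoid

  _≈?_ : ∀ x y → Dec (x ≈ y)
  x ≈? y with enum-surj x | enum-surj y
  ... | i , i≈x | j , j≈y with i Finₚ.≟ j
  ...   | yes ≡.refl = yes (trans (sym i≈x) j≈y)
  ...   | no  i≢j    = no (λ x≈y → i≢j (enum-inj i j (trans i≈x (trans x≈y (sym j≈y)))))

  unit? : ∀ x → Dec (Unit x)
  unit? x with Finₚ.any? (λ i → (x * enum i) ≈? 1#)
  ... | yes (i , xi≈1) = yes (enum i , xi≈1)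
  ... | no  ¬xi≈1      = no λ (y , xy≈1) → let (j , j≈y) = enum-surj y in ¬xi≈1 (j , trans (*-cong refl j≈y) xy≈1)

  ι≈×1# : ∀ n → ι n ≈ n Mult.× 1#
  ι≈×1# zero    = refl
  ι≈×1# (suc n) = +-cong refl (ι≈×1# n)

  ι-* : ∀ m n → ι (m ℕ.* n) ≈ ι m * ι n
  ι-* m n = trans (ι≈×1# (m ℕ.* n)) (trans (Mult.×1-homo-* m n) (sym (*-cong (ι≈×1# m) (ι≈×1# n))))

  PAdicForm : Carrier → Set (c ⊔ ℓ)
  PAdicForm x = x ≈ 0# ⊎ ∃[ r ] (0 < r × r < s × ∃[ v ] (Unit v × x ≈ ι (p ^ r) * v))

  -- Peel off factors p from x = p^k y while y is not a unit; after s − k steps x = p^s y = 0.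
  p-adic-descent : ∀ d {k x y} → k ℕ.+ d ≡ s → 0 < k → x ≈ ι (p ^ k) * y → PAdicForm x
  p-adic-descent zero {k} {x} {y} k+0≡s _ x≈pᵏy = inj₁ (begin
    x              ≈⟨ x≈pᵏy ⟩
    ι (p ^ k) * y  ≡⟨ ≡.cong (λ n → ι (p ^ n) * y) (≡.trans (≡.sym (ℕₚ.+-identityʳ k)) k+0≡s) ⟩
    ι (p ^ s) * y  ≈⟨ *-cong char-kills refl ⟩
    0# * y         ≈⟨ zeroˡ y ⟩
    0#             ∎)
  p-adic-descent (suc d) {k} {x} {y} k+d+1≡s 0<k x≈pᵏy with unit? y
  ... | yes y-unit = inj₂ (k , 0<k , ≡.subst (k <_) k+d+1≡s (ℕₚ.m<m+n k (s≤s z≤n)) , y , y-unit , x≈pᵏy)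
  ... | no  ¬unit  with nonunit⇒pR y ¬unit
  ...   | y' , y≈py' = p-adic-descent d (≡.trans (≡.sym (ℕₚ.+-suc k d)) k+d+1≡s) (s≤s z≤n) (begin
    x                       ≈⟨ x≈pᵏy ⟩
    ι (p ^ k) * y           ≈⟨ *-cong refl y≈py' ⟩
    ι (p ^ k) * (ι p * y')  ≈⟨ sym (*-assoc _ _ _) ⟩
    ι (p ^ k) * ι p * y'    ≈⟨ *-cong (trans (*-comm _ _) (sym (ι-* p (p ^ k)))) refl ⟩
    ι (p ^ suc k) * y'      ∎)

  nonunit-p-adic-form : 1 ≤ s → ∀ x → ¬ Unit x → PAdicForm x
  nonunit-p-adic-form 1≤s x ¬unit with nonunit⇒pR x ¬unit
  ... | y , x≈py = p-adic-descent (s ℕ.∸ 1) (ℕₚ.m+[n∸m]≡n 1≤s) (s≤s z≤n)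
                                  (trans x≈py (*-cong (reflexive (≡.cong ι (≡.sym (ℕₚ.*-identityʳ p)))) refl))

open import Data.Nat using (_+_; _*_)

lemma2p3 : ∀ {c ℓ} (R : CommutativeRing c ℓ) →
    let open RingDefs R in
    let open CommutativeRing R using (Carrier) in (p s m : ℕ) → Prime p → p ≢ 2 → 2 ≤ s → 1 ≤ m → IsGaloisRing p s m →
    (ν δ : ℕ) → 1 ≤ ν → δ ≤ 2 →
    (z : Carrier) → Unit z → ¬ IsSquare z → (b : Bool) →
    let open Orth ν δ z b in
    (α : Vec) → IsVertex α →
    (∃[ i ] (1 ≤ toℕ i × toℕ i < 2 * ν × Unit (α i))) →
    (ν ≡ 1 → Carries α (e 1)) ×
    (2 ≤ ν → Carries α (e ν) ⊎ Carries α (e 1) ⊎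
    (∃[ r ] (0 < r × r < s × Carries α (λ k → CommutativeRing._+_ R (e 1 k) (CommutativeRing._*_ R (ι (p ^ r)) (e ν k))))))
lemma2p3 R p s m _ _ 2≤s _ G ν δ 1≤ν _ z _ _ b α (_ , α-isotropic) (i , 1≤i , i<2ν , αᵢ-unit) =
  ν≡1-case , ν≥2-case
  where
  open CommutativeRing R using (Carrier; 1#; trans; sym; refl; +-cong; *-identityˡ; +-identityʳ; zeroˡ)
  open RingDefs R using (e; ι; Unit)
  open RingDefs.Orth R ν δ z b using (Carries)
  open Hyperbolic R ν δ z b 1≤ν
  open GaloisRing R G

  β : Carrier
  β = B (e 0) α

  carries-e-ν : Unit β → Carries α (e ν)
  carries-e-ν (μ⁻¹ , μμ⁻¹) = ⇝-carries (reach-e-ν α-isotropic refl μμ⁻¹) (μ⁻¹ , μμ⁻¹)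

  ν≡1-case : ν ≡ 1 → Carries α (e 1)
  ν≡1-case ν≡1 with unit-coordinate α i 1≤i i<2ν αᵢ-unit
  ... | inj₁ β-unit              = ≡.subst (λ k → Carries α (e k)) ν≡1 (carries-e-ν β-unit)
  ... | inj₂ (J , J≢0 , J<ν , _) = ⊥-elim (J≢0 (ℕₚ.n<1⇒n≡0 (≡.subst (J <_) ν≡1 J<ν)))

  ν≥2-case : 2 ≤ ν → Carries α (e ν) ⊎ Carries α (e 1) ⊎
                     ∃[ r ] (0 < r × r < s × Carries α (e 1 ⊕ ι (p ^ r) ⊛ e ν))
  ν≥2-case 2≤ν with unit? β | unit-coordinate α i 1≤i i<2ν αᵢ-unit
  ... | yes β-unit | _           = inj₁ (carries-e-ν β-unit)
  ... | no ¬β-unit | inj₁ β-unit = ⊥-elim (¬β-unit β-unit)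
  ... | no ¬β-unit | inj₂ (J , J≢0 , J<ν , unit) with nonunit-p-adic-form (ℕₚ.≤-trans (s≤s z≤n) 2≤s) β ¬β-unit
  ...   | inj₁ β≈0 =
    inj₂ (inj₁ (carries-≋ (carries-normal-form 2≤ν α-isotropic J≢0 J<ν unit (1# , *-identityˡ 1#)
                                               (trans β≈0 (sym (zeroˡ 1#))))
                          (λ k → trans (+-cong refl (zeroˡ _)) (+-identityʳ _))))
  ...   | inj₂ (r , 0<r , r<s , v , v-unit , β≈pʳv) =
    inj₂ (inj₂ (r , 0<r , r<s , carries-normal-form 2≤ν α-isotropic J≢0 J<ν unit v-unit β≈pʳv))
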